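{- Let $n\geq 2$ and let $F\subseteq V(Q_n^3)$ be a vertex cut of $Q_n^3$ (i.e. $Q_n^3-F$ is disconnected) with $|F|\leq 4n-4$. Then $Q_n^3-F$ has exactly two components, one of which is a single vertex.
   Context: The $3$-ary $n$-cube $Q_n^3$ is the graph whose vertices are the strings $u=u_{n-1}u_{n-2}\cdots u_0$ with $u_i\in\{0,1,2\}$, two vertices $u,v$ being adjacent if and only if there is an index $j$ with $u_j=v_j\pm 1 \pmod 3$ and $u_i=v_i$ for all $i\neq j$. -}

module Defs where

open import Data.Nat using (ℕ)
open import Data.Fin using (Fin; zero; suc)
open import Data.Vec using (Vec; lookup)
open import Data.Product using (Σ; _×_)
open import Data.Sum using (_⊎_)
open import Data.List using (List)
open import Data.List.Membership.Propositional using (_∈_)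
open import Relation.Nullary using (¬_)
open import Relation.Binary.PropositionalEquality using (_≡_)
open import Relation.Binary.Construct.Closure.ReflexiveTransitive using (Star)

Vertex : ℕ → Set
Vertex n = Vec (Fin 3) n

plus1 : Fin 3 → Fin 3
plus1 zero = suc zero
plus1 (suc zero) = suc (suc zero)
plus1 (suc (suc zero)) = zero

minus1 : Fin 3 → Fin 3
minus1 zero = suc (suc zero)
minus1 (suc zero) = zero
minus1 (suc (suc zero)) = suc zero

Adj : {n : ℕ} → Vertex n → Vertex n → Set
Adj {n} u v = Σ (Fin n) λ j →
  ((lookup u j ≡ plus1 (lookup v j)) ⊎ (lookup u j ≡ minus1 (lookup v j)))
  × ((i : Fin n) → ¬ (i ≡ j) → lookup u i ≡ lookup v i)

-- the vertex set F ⊆ V(Q_n^3) is given as a list of vertices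
-- edges of Q_n^3 - F
EdgeMinus : {n : ℕ} → List (Vertex n) → Vertex n → Vertex n → Set
EdgeMinus F u v = Adj u v × ¬ (u ∈ F) × ¬ (v ∈ F)

Connected : {n : ℕ} → List (Vertex n) → Vertex n → Vertex n → Set
Connected F = Star (EdgeMinus F)

Disconnected : {n : ℕ} → List (Vertex n) → Set
Disconnected {n} F = Σ (Vertex n) λ u → Σ (Vertex n) λ v →
  ¬ (u ∈ F) × ¬ (v ∈ F) × ¬ Connected F u v

-- Q_n^3 - F has exactly two components, one of which is the single vertex x:
-- x survives, x is connected to no other surviving vertex, the remaining
-- surviving vertices are pairwise connected, and at least one other vertex survives.
TwoComponentsOneTrivial : {n : ℕ} → List (Vertex n) → Set
TwoComponentsOneTrivial {n} F = Σ (Vertex n) λ x →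
  ¬ (x ∈ F)
  × ((y : Vertex n) → ¬ (y ∈ F) → Connected F x y → y ≡ x)
  × ((y z : Vertex n) → ¬ (y ∈ F) → ¬ (z ∈ F) → ¬ (y ≡ x) → ¬ (z ≡ x) → Connected F y z)
  × Σ (Vertex n) (λ w → ¬ (w ∈ F) × ¬ (w ≡ x))

-- Split Q_n^3 into three copies of Q_{n-1}^3 by the leading coordinate and induct on n.
-- The copy c with the fewest faults holds at most a third of them and is connected by
-- induction.  A survivor a ∷ x of another copy steps straight to c ∷ x unless that vertex is
-- a fault; then c already holds a fault, so the copy a has few enough faults to be connected
-- by induction itself, and x is routed inside it to a string z that is fault-free in both
-- copies (such z exists because few faults cannot cover 3^(n-1) strings), and on to c ∷ z.
-- With fewer than 2n faults this gives connectivity outright.  With at most 4n - 4 faults it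
-- gives connectivity of the survivors having a surviving neighbour, using the 2n bound for
-- the auxiliary copies; two distinct vertices share at most two neighbours, so two isolated
-- survivors would need 4n - 2 faults, and at most one survivor is isolated.

module Submission where

open import Defs
open import Data.Nat using (ℕ; zero; suc; _+_; _*_; _∸_; _^_; _≤_; _<_; _≤?_; z≤n; s≤s)
open import Data.Nat.Properties hiding (_≟_; suc-injective)
open import Data.Nat.Tactic.RingSolver using (solve-∀)
open import Data.Fin using (Fin; zero; suc)
open import Data.Fin.Patterns using (0F; 1F; 2F)
open import Data.Fin.Properties using (_≟_; all?; any?; suc-injective)
open import Data.Vec using ([]; _∷_)
open import Data.Vec.Properties using (≡-dec)
open import Data.Vec.Relation.Binary.Pointwise.Extensional using (ext; Pointwise-≡⇒≡)
open import Data.List using (List; []; _∷_; length; _++_)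
open import Data.List.Properties using (length-++)
open import Data.List.Membership.Propositional using (_∈_; _∉_)
open import Data.List.Membership.Propositional.Properties using (∈-++⁺ˡ; ∈-++⁺ʳ; ∈-++⁻)
open import Data.List.Relation.Unary.Any as Any using (here; there)
open import Data.Product using (Σ; ∃; _×_; _,_; proj₁; proj₂)
open import Data.Sum using (_⊎_; inj₁; inj₂; [_,_]′)
open import Data.Empty using (⊥; ⊥-elim)
open import Function using (_∘_; id)
open import Relation.Nullary using (Dec; yes; no; ¬?)
open import Relation.Nullary.Decidable using (from-yes; _→-dec_; _×-dec_; _⊎-dec_)
open import Relation.Binary.PropositionalEquality
open import Relation.Binary.Construct.Closure.ReflexiveTransitive using (ε; _◅_; _◅◅_; gmap; reverse)

private
  variable
    n k : ℕ


≢⇒±1 : ∀ a b → a ≢ b → a ≡ plus1 b ⊎ a ≡ minus1 b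
≢⇒±1 = from-yes (all? λ a → all? λ b → ¬? (a ≟ b) →-dec (a ≟ plus1 b ⊎-dec a ≟ minus1 b))

±1⇒≢ : ∀ a b → a ≡ plus1 b ⊎ a ≡ minus1 b → a ≢ b
±1⇒≢ = from-yes (all? λ a → all? λ b → (a ≟ plus1 b ⊎-dec a ≟ minus1 b) →-dec ¬? (a ≟ b))

Distinct₃ : Fin 3 → Fin 3 → Fin 3 → Set
Distinct₃ a b c = a ≢ b × b ≢ c × a ≢ c

±1-distinct : ∀ a → Distinct₃ a (plus1 a) (minus1 a)
±1-distinct = from-yes (all? λ a →
  ¬? (a ≟ plus1 a) ×-dec ¬? (plus1 a ≟ minus1 a) ×-dec ¬? (a ≟ minus1 a))

third : ∀ a b → a ≢ b → ∃ λ c → Distinct₃ a b c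
third = from-yes (all? λ (a : Fin 3) → all? λ b → ¬? (a ≟ b) →-dec any? λ c →
  ¬? (a ≟ b) ×-dec ¬? (b ≟ c) ×-dec ¬? (a ≟ c))

distinct₃-cover : ∀ a b c → Distinct₃ a b c → ∀ d → d ≡ a ⊎ d ≡ b ⊎ d ≡ c
distinct₃-cover = from-yes (all? λ (a : Fin 3) → all? λ b → all? λ c →
  (¬? (a ≟ b) ×-dec ¬? (b ≟ c) ×-dec ¬? (a ≟ c)) →-dec
  all? λ d → d ≟ a ⊎-dec d ≟ b ⊎-dec d ≟ c)

-- In Fin 3 every b ≢ a is a ± 1, so adjacency in Q_n^3 is just "differ in exactly
-- one coordinate", which we phrase by recursion on the leading coordinate.
infix 4 _∼_
data _∼_ : Vertex n → Vertex n → Set where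
  head : ∀ {a b} {x : Vertex n} → a ≢ b → (a ∷ x) ∼ (b ∷ x)
  tail : ∀ {a} {x y : Vertex n} → x ∼ y → (a ∷ x) ∼ (a ∷ y)

∼-sym : {x y : Vertex n} → x ∼ y → y ∼ x
∼-sym (head a≢b) = head (a≢b ∘ sym)
∼-sym (tail x∼y) = tail (∼-sym x∼y)

∼⇒≢ : {x y : Vertex n} → x ∼ y → x ≢ y
∼⇒≢ (head a≢b) refl = a≢b refl
∼⇒≢ (tail x∼y) refl = ∼⇒≢ x∼y refl

Adj⇒∼ : {u v : Vertex n} → Adj u v → u ∼ v
Adj⇒∼ {u = a ∷ x} {b ∷ y} (zero , a≡b±1 , same)
  with refl ← Pointwise-≡⇒≡ {xs = x} {y} (ext λ i → same (suc i) λ ())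
  = head (±1⇒≢ a b a≡b±1)
Adj⇒∼ {u = a ∷ x} {b ∷ y} (suc j , xj≡yj±1 , same)
  with refl ← same zero (λ ())
  = tail (Adj⇒∼ (j , xj≡yj±1 , λ i i≢j → same (suc i) (i≢j ∘ suc-injective)))

∼⇒Adj : {u v : Vertex n} → u ∼ v → Adj u v
∼⇒Adj (head {a = a} {b} a≢b) = zero , ≢⇒±1 a b a≢b , λ { zero 0≢0 → ⊥-elim (0≢0 refl) ; (suc i) _ → refl }
∼⇒Adj (tail x∼y) with ∼⇒Adj x∼y
... | j , xj≡yj±1 , same = suc j , xj≡yj±1 , λ { zero _ → refl ; (suc i) i≢j → same i (i≢j ∘ cong suc) }

_≟ᵥ_ : (u v : Vertex n) → Dec (u ≡ v)
_≟ᵥ_ = ≡-dec _≟_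

_∈?_ : (x : Vertex n) (L : List (Vertex n)) → Dec (x ∈ L)
x ∈? L = Any.any? (x ≟ᵥ_) L

layer : Fin 3 → List (Vertex (suc n)) → List (Vertex n)
layer a [] = []
layer a ((b ∷ x) ∷ L) with a ≟ b
... | yes _ = x ∷ layer a L
... | no _ = layer a L

∈-layer⁺ : ∀ {a} {x : Vertex n} L → (a ∷ x) ∈ L → x ∈ layer a L
∈-layer⁺ {a = a} ((b ∷ y) ∷ L) (here a∷x≡b∷y) with a ≟ b | a∷x≡b∷y
... | yes _ | refl = here refl
... | no a≢b | refl = ⊥-elim (a≢b refl)
∈-layer⁺ {a = a} ((b ∷ y) ∷ L) (there a∷x∈L) with a ≟ b
... | yes _ = there (∈-layer⁺ L a∷x∈L)
... | no _ = ∈-layer⁺ L a∷x∈L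

∈-layer⁻ : ∀ {a} {x : Vertex n} L → x ∈ layer a L → (a ∷ x) ∈ L
∈-layer⁻ {a = a} ((b ∷ y) ∷ L) x∈ with a ≟ b | x∈
... | yes refl | here refl = here refl
... | yes _ | there x∈′ = there (∈-layer⁻ L x∈′)
... | no _ | x∈′ = there (∈-layer⁻ L x∈′)

faults : Fin 3 → List (Vertex (suc n)) → ℕ
faults a L = length (layer a L)

faults-∷-≡ : ∀ {a} (x : Vertex n) L → faults a ((a ∷ x) ∷ L) ≡ suc (faults a L)
faults-∷-≡ {a = a} x L with a ≟ a
... | yes _ = refl
... | no a≢a = ⊥-elim (a≢a refl)

faults-∷-≢ : ∀ {a b} (x : Vertex n) L → a ≢ b → faults a ((b ∷ x) ∷ L) ≡ faults a L
faults-∷-≢ {a = a} {b} x L a≢b with a ≟ b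
... | yes a≡b = ⊥-elim (a≢b a≡b)
... | no _ = refl

sum₃-cong : ∀ {p q r p′ q′ r′} → p ≡ p′ → q ≡ q′ → r ≡ r′ → p + q + r ≡ p′ + q′ + r′
sum₃-cong refl refl refl = refl

length-layers : ∀ {a b c} → Distinct₃ a b c → (L : List (Vertex (suc n))) →
  length L ≡ faults a L + faults b L + faults c L
length-layers abc [] = refl
length-layers {a = a} {b} {c} abc@(a≢b , b≢c , a≢c) ((d ∷ x) ∷ L)
  with distinct₃-cover a b c abc d
... | inj₁ refl = begin
  suc (length L)                                    ≡⟨ cong suc (length-layers abc L) ⟩
  suc (faults a L) + faults b L + faults c L         ≡˘⟨ sum₃-cong (faults-∷-≡ x L)
                                                          (faults-∷-≢ x L (a≢b ∘ sym)) (faults-∷-≢ x L (a≢c ∘ sym)) ⟩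
  _ ∎
  where open ≡-Reasoning
... | inj₂ (inj₁ refl) = begin
  suc (length L)                                    ≡⟨ cong suc (length-layers abc L) ⟩
  suc (faults a L + faults b L) + faults c L         ≡˘⟨ cong (_+ faults c L) (+-suc (faults a L) (faults b L)) ⟩
  faults a L + suc (faults b L) + faults c L         ≡˘⟨ sum₃-cong (faults-∷-≢ x L a≢b)
                                                          (faults-∷-≡ x L) (faults-∷-≢ x L (b≢c ∘ sym)) ⟩
  _ ∎
  where open ≡-Reasoning
... | inj₂ (inj₂ refl) = begin
  suc (length L)                                    ≡⟨ cong suc (length-layers abc L) ⟩
  suc (faults a L + faults b L + faults c L)         ≡˘⟨ +-suc (faults a L + faults b L) (faults c L) ⟩
  faults a L + faults b L + suc (faults c L)         ≡˘⟨ sum₃-cong (faults-∷-≢ x L a≢c)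
                                                          (faults-∷-≢ x L b≢c) (faults-∷-≡ x L) ⟩
  _ ∎
  where open ≡-Reasoning

≤-length-layers : ∀ {a b c p q r} → Distinct₃ a b c → (L : List (Vertex (suc n))) →
  p ≤ faults a L → q ≤ faults b L → r ≤ faults c L → p + q + r ≤ length L
≤-length-layers abc L p≤ q≤ r≤ =
  ≤-trans (+-mono-≤ (+-mono-≤ p≤ q≤) r≤) (≤-reflexive (sym (length-layers abc L)))

lightest : (f : Fin 3 → ℕ) → ∃ λ c → ∀ a → f c ≤ f a
lightest f with f 0F ≤? f 1F | f 0F ≤? f 2F | f 1F ≤? f 2F
... | yes 0≤1 | yes 0≤2 | _ = 0F , λ { 0F → ≤-refl ; 1F → 0≤1 ; 2F → 0≤2 }
... | yes 0≤1 | no 0≰2 | _ = 2F , λ { 0F → <⇒≤ (≰⇒> 0≰2) ; 1F → ≤-trans (<⇒≤ (≰⇒> 0≰2)) 0≤1 ; 2F → ≤-refl }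
... | no 0≰1 | _ | yes 1≤2 = 1F , λ { 0F → <⇒≤ (≰⇒> 0≰1) ; 1F → ≤-refl ; 2F → 1≤2 }
... | no 0≰1 | _ | no 1≰2 = 2F , λ { 0F → ≤-trans (<⇒≤ (≰⇒> 1≰2)) (<⇒≤ (≰⇒> 0≰1)) ; 1F → <⇒≤ (≰⇒> 1≰2) ; 2F → ≤-refl }

Lightest : Fin 3 → List (Vertex (suc n)) → Set
Lightest c L = ∀ a → faults c L ≤ faults a L

lightest-layer : (L : List (Vertex (suc n))) → ∃ λ c → Lightest c L
lightest-layer L = lightest (λ a → faults a L)

lightest⇒3*≤length : ∀ {c} L → Lightest {n} c L → 3 * faults c L ≤ length L
lightest⇒3*≤length {c = c} L min = begin
  3 * faults c L                          ≡⟨ 3*r≡r+r+r (faults c L) ⟩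
  faults c L + faults c L + faults c L   ≤⟨ ≤-length-layers (±1-distinct c) L ≤-refl (min (plus1 c)) (min (minus1 c)) ⟩
  length L                                ∎
  where
  open ≤-Reasoning
  3*r≡r+r+r : ∀ r → 3 * r ≡ r + r + r
  3*r≡r+r+r = solve-∀

4*n≤3^n+1 : ∀ n → 4 * n ≤ 3 ^ n + 1
4*n≤3^n+1 0 = z≤n
4*n≤3^n+1 1 = ≤-refl
4*n≤3^n+1 (suc (suc n)) = begin
  4 * suc (suc n)               ≡⟨ shift n ⟩
  4 * suc n + 4                 ≤⟨ +-mono-≤ (4*n≤3^n+1 (suc n)) (*-monoʳ-≤ 2 2≤3^[1+n]) ⟩
  3 ^ suc n + 1 + 2 * 3 ^ suc n ≡⟨ collect (3 ^ suc n) ⟩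
  3 * 3 ^ suc n + 1             ∎
  where
  open ≤-Reasoning
  2≤3^[1+n] : 2 ≤ 3 ^ suc n
  2≤3^[1+n] = ≤-trans (n≤1+n 2) (*-monoʳ-≤ 3 (m^n>0 3 n))
  shift : ∀ n → 4 * suc (suc n) ≡ 4 * suc n + 4
  shift = solve-∀
  collect : ∀ t → t + 1 + 2 * t ≡ 3 * t + 1
  collect = solve-∀

∉-witness : ∀ n (L : List (Vertex n)) → length L < 3 ^ n → ∃ λ z → z ∉ L
∉-witness zero [] _ = [] , λ ()
∉-witness zero (_ ∷ _) (s≤s ())
∉-witness (suc n) L |L|<3^[1+n] with lightest-layer L
... | c , min with ∉-witness n (layer c L)
      (*-cancelˡ-< 3 _ _ (≤-<-trans (lightest⇒3*≤length L min) |L|<3^[1+n]))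
... | z , z∉ = c ∷ z , z∉ ∘ ∈-layer⁺ L

common-∉-witness : (P Q : List (Vertex n)) → length P + length Q + 2 ≤ 4 * n →
  ∃ λ z → z ∉ P × z ∉ Q
common-∉-witness {n} P Q few with ∉-witness n (P ++ Q) (+-cancelʳ-≤ 1 _ _ (begin
    suc (length (P ++ Q)) + 1  ≡⟨ cong (λ t → suc t + 1) (length-++ P) ⟩
    suc (length P + length Q) + 1  ≡˘⟨ +-suc (length P + length Q) 1 ⟩
    length P + length Q + 2  ≤⟨ few ⟩
    4 * n  ≤⟨ 4*n≤3^n+1 n ⟩
    3 ^ n + 1  ∎))
  where open ≤-Reasoning
... | z , z∉P++Q = z , z∉P++Q ∘ ∈-++⁺ˡ , z∉P++Q ∘ ∈-++⁺ʳ P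

Isolated : List (Vertex n) → Vertex n → Set
Isolated L x = ∀ {y} → x ∼ y → y ∈ L

HasLiveNeighbour : List (Vertex n) → Vertex n → Set
HasLiveNeighbour L x = ∃ λ y → x ∼ y × y ∉ L

module _ {L : List (Vertex (suc n))} {x : Vertex n} where

  isolated-layer : ∀ {a} → Isolated L (a ∷ x) → Isolated (layer a L) x
  isolated-layer I x∼y = ∈-layer⁺ L (I (tail x∼y))

  isolated⇒∈-layer : ∀ {a b} → Isolated L (a ∷ x) → a ≢ b → x ∈ layer b L
  isolated⇒∈-layer I a≢b = ∈-layer⁺ L (I (head a≢b))

  isolated-from-layer : ∀ {a} → Isolated (layer a L) x → (∀ {b} → a ≢ b → (b ∷ x) ∈ L) → Isolated L (a ∷ x)
  isolated-from-layer I other (head a≢b) = other a≢b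
  isolated-from-layer I other (tail x∼y) = ∈-layer⁻ L (I x∼y)

isolated-or-live : ∀ L (x : Vertex n) → Isolated L x ⊎ HasLiveNeighbour L x
isolated-or-live L [] = inj₁ λ ()
isolated-or-live L (a ∷ x) with (plus1 a ∷ x) ∈? L | (minus1 a ∷ x) ∈? L | isolated-or-live (layer a L) x
... | no a⁺∉ | _ | _ = inj₂ (_ , head (proj₁ (±1-distinct a)) , a⁺∉)
... | _ | no a⁻∉ | _ = inj₂ (_ , head (proj₂ (proj₂ (±1-distinct a))) , a⁻∉)
... | _ | _ | inj₂ (y , x∼y , y∉) = inj₂ (a ∷ y , tail x∼y , y∉ ∘ ∈-layer⁺ L)
... | yes a⁺∈ | yes a⁻∈ | inj₁ I = inj₁ (isolated-from-layer I λ {b} a≢b →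
  [ (λ { refl → a⁺∈ }) , (λ { refl → a⁻∈ }) ]′ (≢⇒±1 b a (a≢b ∘ sym)))

∈⇒1≤length : ∀ {A : Set} {x : A} {L} → x ∈ L → 1 ≤ length L
∈⇒1≤length (here _) = s≤s z≤n
∈⇒1≤length (there _) = s≤s z≤n

∈⇒2≤length : ∀ {A : Set} {x y : A} {L} → x ≢ y → x ∈ L → y ∈ L → 2 ≤ length L
∈⇒2≤length x≢y (here refl) (here refl) = ⊥-elim (x≢y refl)
∈⇒2≤length x≢y (here _) (there y∈) = s≤s (∈⇒1≤length y∈)
∈⇒2≤length x≢y (there x∈) (here _) = s≤s (∈⇒1≤length x∈)
∈⇒2≤length x≢y (there x∈) (there y∈) = m≤n⇒m≤1+n (∈⇒2≤length x≢y x∈ y∈)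

-- k is 1 when x is itself one of the faults and may be counted together with its neighbours.
data SelfCount (L : List (Vertex n)) (x : Vertex n) : ℕ → Set where
  uncounted : SelfCount L x 0
  counted : x ∈ L → SelfCount L x 1

selfCount-layer : ∀ {a L} {x : Vertex n} → SelfCount L (a ∷ x) k → SelfCount (layer a L) x k
selfCount-layer uncounted = uncounted
selfCount-layer {L = L} (counted a∷x∈L) = counted (∈-layer⁺ L a∷x∈L)

selfCount≤length : ∀ {L} {x : Vertex n} → SelfCount L x k → k ≤ length L
selfCount≤length uncounted = z≤n
selfCount≤length (counted x∈L) = ∈⇒1≤length x∈L

isolated-size : ∀ n {k L} {x : Vertex n} → Isolated L x → SelfCount L x k → k + 2 * n ≤ length L
isolated-size zero {k} I s = ≤-trans (≤-reflexive (+-identityʳ k)) (selfCount≤length s)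
isolated-size (suc n) {k} {L} {a ∷ x} I s = begin
  k + 2 * suc n          ≡⟨ shift n k ⟩
  k + 2 * n + 1 + 1      ≤⟨ ≤-length-layers a⁺⁻ L (isolated-size n (isolated-layer I) (selfCount-layer s))
                              (∈⇒1≤length (isolated⇒∈-layer I a≢a⁺)) (∈⇒1≤length (isolated⇒∈-layer I a≢a⁻)) ⟩
  length L               ∎
  where
  open ≤-Reasoning
  a⁺⁻ = ±1-distinct a
  a≢a⁺ = proj₁ a⁺⁻
  a≢a⁻ = proj₂ (proj₂ a⁺⁻)
  shift : ∀ n k → k + 2 * suc n ≡ k + 2 * n + 1 + 1
  shift = solve-∀

-- Distinct vertices have at most two common neighbours.
isolated-pair-size : ∀ n {k L} {x z : Vertex n} → Isolated L x → Isolated L z → x ≢ z → z ∉ L →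
  SelfCount L x k → k + 4 * n ≤ length L + 2
isolated-pair-size zero {k} I J x≢z z∉ s =
  ≤-trans (≤-reflexive (+-identityʳ k)) (≤-trans (selfCount≤length s) (m≤m+n _ 2))
isolated-pair-size (suc n) {k} {L} {a ∷ x} {b ∷ z} I J a∷x≢b∷z z∉ s with a ≟ b
... | yes refl = begin
  k + 4 * suc n             ≡⟨ shift n k ⟩
  k + 4 * n + 2 + 2         ≤⟨ +-monoˡ-≤ 2 (+-monoˡ-≤ 2 (isolated-pair-size n (isolated-layer I) (isolated-layer J)
                                 x≢z (z∉ ∘ ∈-layer⁻ L) (selfCount-layer s))) ⟩
  faults a L + 2 + 2 + 2    ≤⟨ +-monoˡ-≤ 2 (≤-length-layers a⁺⁻ L ≤-refl (both a≢a⁺) (both a≢a⁻)) ⟩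
  length L + 2              ∎
  where
  open ≤-Reasoning
  x≢z = a∷x≢b∷z ∘ cong (a ∷_)
  a⁺⁻ = ±1-distinct a
  a≢a⁺ = proj₁ a⁺⁻
  a≢a⁻ = proj₂ (proj₂ a⁺⁻)
  both : ∀ {d} → a ≢ d → 2 ≤ faults d L
  both a≢d = ∈⇒2≤length x≢z (isolated⇒∈-layer I a≢d) (isolated⇒∈-layer J a≢d)
  shift : ∀ n k → k + 4 * suc n ≡ k + 4 * n + 2 + 2
  shift = solve-∀
... | no a≢b with x ≟ᵥ z
...   | yes refl = ⊥-elim (z∉ (I (head a≢b)))
...   | no x≢z with third a b a≢b
...     | c , abc@(_ , b≢c , a≢c) = begin
  k + 4 * suc n                     ≡⟨ shift n k ⟩
  k + 2 * n + 2 * n + 2 + 2         ≤⟨ +-monoˡ-≤ 2 (≤-length-layers abc L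
                                         (isolated-size n (isolated-layer I) (selfCount-layer s))
                                         (isolated-size n (isolated-layer J) uncounted)
                                         (∈⇒2≤length x≢z (isolated⇒∈-layer I a≢c) (isolated⇒∈-layer J b≢c))) ⟩
  length L + 2                      ∎
  where
  open ≤-Reasoning
  shift : ∀ n k → k + 4 * suc n ≡ k + 2 * n + 2 * n + 2 + 2
  shift = solve-∀

LiveConnected : List (Vertex n) → Set
LiveConnected L = ∀ u v → u ∉ L → v ∉ L → Connected L u v

module _ {L : List (Vertex n)} where

  edge : ∀ {u v} → u ∼ v → u ∉ L → v ∉ L → Connected L u v
  edge u∼v u∉ v∉ = (∼⇒Adj u∼v , u∉ , v∉) ◅ ε

  connected-sym : ∀ {u v} → Connected L u v → Connected L v u
  connected-sym = reverse λ {u} {v} (uv , u∉ , v∉) → ∼⇒Adj (∼-sym (Adj⇒∼ {u = u} {v} uv)) , v∉ , u∉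

module _ {L : List (Vertex (suc n))} where

  lift-layer : ∀ a {x y} → Connected (layer a L) x y → Connected L (a ∷ x) (a ∷ y)
  lift-layer a = gmap (a ∷_) λ {x} {y} (xy , x∉ , y∉) → ∼⇒Adj (tail (Adj⇒∼ {u = x} {y} xy)) , x∉ ∘ ∈-layer⁺ L , y∉ ∘ ∈-layer⁺ L

  edge-across : ∀ {a b x} → a ≢ b → x ∉ layer a L → x ∉ layer b L → Connected L (a ∷ x) (b ∷ x)
  edge-across a≢b x∉a x∉b = edge (head a≢b) (x∉a ∘ ∈-layer⁺ L) (x∉b ∘ ∈-layer⁺ L)

ReachesLayer : List (Vertex (suc n)) → Fin 3 → Vertex (suc n) → Set
ReachesLayer {n} L c u = Σ (Vertex n) λ z → z ∉ layer c L × Connected L u (c ∷ z)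

connected-via-layer : ∀ {c} L → LiveConnected (layer c L) → ∀ {u v : Vertex (suc n)} →
  ReachesLayer L c u → ReachesLayer L c v → Connected L u v
connected-via-layer {c = c} L conn (z , z∉ , u⇝z) (z′ , z′∉ , v⇝z′) =
  u⇝z ◅◅ lift-layer c (conn z z′ z∉ z′∉) ◅◅ connected-sym v⇝z′

reaches-or-blocked : ∀ {a} c L {x : Vertex n} → (a ∷ x) ∉ L →
  ReachesLayer L c (a ∷ x) ⊎ (a ≢ c × x ∈ layer c L)
reaches-or-blocked {a = a} c L {x} a∷x∉ with a ≟ c | (c ∷ x) ∈? L
... | yes refl | _ = inj₁ (x , a∷x∉ ∘ ∈-layer⁻ L , ε)
... | no a≢c | no c∷x∉ = inj₁ (x , c∷x∉ ∘ ∈-layer⁻ L , edge (head a≢c) a∷x∉ c∷x∉)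
... | no a≢c | yes c∷x∈ = inj₂ (a≢c , ∈-layer⁺ L c∷x∈)

lightest-few : ∀ {r t} → 3 * r ≤ t → t ≤ 4 * suc n → r < 2 * suc n
lightest-few {n} {r} {t} 3r≤t t≤4m = *-cancelˡ-< 3 r (2 * suc n) (begin-strict
  3 * r          ≤⟨ 3r≤t ⟩
  t              ≤⟨ t≤4m ⟩
  4 * suc n      <⟨ *-monoˡ-< (suc n) {4} {6} (s≤s (s≤s (s≤s (s≤s (s≤s z≤n))))) ⟩
  6 * suc n      ≡⟨ *-assoc 3 2 (suc n) ⟩
  3 * (2 * suc n) ∎)
  where open ≤-Reasoning

module ConnectivityStep {n} (connected-layers : ∀ (L : List (Vertex (suc n))) → length L < 2 * suc n → LiveConnected L)
  (L : List (Vertex (suc (suc n)))) (few : length L < 2 * suc (suc n)) (c : Fin 3) (c-lightest : Lightest c L) where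

  2*[2+n]≤4*[1+n] : 2 * suc (suc n) ≤ 4 * suc n
  2*[2+n]≤4*[1+n] = ≤-trans (m≤m+n _ (2 * n)) (≤-reflexive (e n))
    where
    e : ∀ n → 2 * suc (suc n) + 2 * n ≡ 4 * suc n
    e = solve-∀

  layer-c-connected : LiveConnected (layer c L)
  layer-c-connected = connected-layers _ (lightest-few (lightest⇒3*≤length L c-lightest) total≤4m)
    where
    total≤4m : length L ≤ 4 * suc n
    total≤4m = <⇒≤ (≤-trans few 2*[2+n]≤4*[1+n])

  -- c ∷ x is a fault, and c is the lightest copy, so the copy a keeps fewer than 2(n - 1).
  reach-blocked : ∀ {a x} → (a ∷ x) ∉ L → a ≢ c → x ∈ layer c L → ReachesLayer L c (a ∷ x)
  reach-blocked {a} {x} u∉ a≢c x∈c =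
    let z , z∉a , z∉c = common-∉-witness (layer a L) (layer c L) room
    in z , z∉c , lift-layer a (connected-layers (layer a L) a-few x z (u∉ ∘ ∈-layer⁻ L) z∉a) ◅◅ edge-across a≢c z∉a z∉c
    where
    open ≤-Reasoning
    b = proj₁ (third a c a≢c)
    acb = proj₂ (third a c a≢c)
    p = faults a L
    r = faults c L
    q = faults b L
    1≤r = ∈⇒1≤length x∈c
    1≤q = ≤-trans 1≤r (c-lightest b)
    few′ : suc (p + r + q) ≤ 2 * suc (suc n)
    few′ = subst (λ t → suc t ≤ _) (length-layers acb L) few
    a-few : p < 2 * suc n
    a-few = +-cancelʳ-≤ 2 _ _ (begin
      suc p + 2               ≡⟨ e₁ p ⟩
      suc (p + 1 + 1)         ≤⟨ s≤s (+-mono-≤ (+-monoʳ-≤ p 1≤r) 1≤q) ⟩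
      suc (p + r + q)         ≤⟨ few′ ⟩
      2 * suc (suc n)         ≡⟨ e₂ n ⟩
      2 * suc n + 2           ∎)
      where
      e₁ : ∀ p → suc p + 2 ≡ suc (p + 1 + 1)
      e₁ = solve-∀
      e₂ : ∀ n → 2 * suc (suc n) ≡ 2 * suc n + 2
      e₂ = solve-∀
    room : p + r + 2 ≤ 4 * suc n
    room = begin
      p + r + 2               ≡⟨ +-suc (p + r) 1 ⟩
      suc (p + r + 1)         ≤⟨ s≤s (+-monoʳ-≤ (p + r) 1≤q) ⟩
      suc (p + r + q)         ≤⟨ few′ ⟩
      2 * suc (suc n)         ≤⟨ 2*[2+n]≤4*[1+n] ⟩
      4 * suc n               ∎

  reach : ∀ {u} → u ∉ L → ReachesLayer L c u
  reach {a ∷ x} u∉ = [ id , (λ (a≢c , x∈c) → reach-blocked u∉ a≢c x∈c) ]′ (reaches-or-blocked c L u∉)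

  connected : LiveConnected L
  connected u v u∉ v∉ = connected-via-layer L layer-c-connected (reach u∉) (reach v∉)

connectivity : ∀ n (L : List (Vertex n)) → length L < 2 * n → LiveConnected L
connectivity 0 L ()
connectivity 1 L _ (a ∷ []) (b ∷ []) a∉ b∉ with a ≟ b
... | yes refl = ε
... | no a≢b = edge (head a≢b) a∉ b∉
connectivity (suc (suc n)) L few =
  let c , c-lightest = lightest-layer L in ConnectivityStep.connected (connectivity (suc n)) L few c c-lightest

NonIsolatedConnected : List (Vertex n) → Set
NonIsolatedConnected L = ∀ u v → u ∉ L → v ∉ L → HasLiveNeighbour L u → HasLiveNeighbour L v → Connected L u v

module SuperStep {n} (super-layers : ∀ (L : List (Vertex (suc n))) → length L + 4 ≤ 4 * suc n → NonIsolatedConnected L)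
  (L : List (Vertex (suc (suc n)))) (few : length L + 4 ≤ 4 * suc (suc n)) (c : Fin 3) (c-lightest : Lightest c L) where

  total : length L ≤ 4 * suc n
  total = +-cancelʳ-≤ 4 _ _ (≤-trans few (≤-reflexive (e n)))
    where
    e : ∀ n → 4 * suc (suc n) ≡ 4 * suc n + 4
    e = solve-∀

  layer-c-connected : LiveConnected (layer c L)
  layer-c-connected = connectivity (suc n) _ (lightest-few (lightest⇒3*≤length L c-lightest) total)

  cancel-2m : ∀ {s} → 2 * suc n + s ≤ 4 * suc n → s ≤ 2 * suc n
  cancel-2m h = +-cancelˡ-≤ (2 * suc n) _ _ (≤-trans h (≤-reflexive (e n)))
    where
    e : ∀ n → 4 * suc n ≡ 2 * suc n + 2 * suc n
    e = solve-∀

  module Blocked {a b x} (acb : Distinct₃ a c b) (u∉ : (a ∷ x) ∉ L) (x∈c : x ∈ layer c L) where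

    a≢c : a ≢ c
    a≢c = proj₁ acb

    a≢b : a ≢ b
    a≢b = proj₂ (proj₂ acb)

    b≢c : b ≢ c
    b≢c = proj₁ (proj₂ acb) ∘ sym

    p r q : ℕ
    p = faults a L
    r = faults c L
    q = faults b L

    x∉a : x ∉ layer a L
    x∉a = u∉ ∘ ∈-layer⁻ L

    total′ : p + r + q ≤ 4 * suc n
    total′ = subst (_≤ 4 * suc n) (length-layers acb L) total

    room-a-c : 2 ≤ q → p + r + 2 ≤ 4 * suc n
    room-a-c 2≤q = ≤-trans (+-monoʳ-≤ (p + r) 2≤q) total′

    a-few : 2 ≤ r → 2 ≤ q → p + 4 ≤ 4 * suc n
    a-few 2≤r 2≤q = ≤-trans (≤-reflexive (sym (+-assoc p 2 2))) (≤-trans (+-mono-≤ (+-monoʳ-≤ p 2≤r) 2≤q) total′)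

    too-many : 2 * suc n ≤ p → 2 * suc n ≤ q → 1 ≤ r → ⊥
    too-many 2m≤p 2m≤q 1≤r = m+1+n≰m (4 * suc n) (begin
      4 * suc n + 1              ≡⟨ e n ⟩
      2 * suc n + 1 + 2 * suc n  ≤⟨ +-mono-≤ (+-mono-≤ 2m≤p 1≤r) 2m≤q ⟩
      p + r + q                  ≤⟨ total′ ⟩
      4 * suc n                  ∎)
      where
      open ≤-Reasoning
      e : ∀ n → 4 * suc n + 1 ≡ 2 * suc n + 1 + 2 * suc n
      e = solve-∀

    b-few : 2 * suc n ≤ p → 2 ≤ r → q < 2 * suc n
    b-few 2m≤p 2≤r = ≤-trans (n≤1+n (suc q)) (≤-trans (≤-reflexive (+-comm 2 q)) (cancel-2m (begin
      2 * suc n + (q + 2)        ≡⟨ e (2 * suc n) q ⟩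
      2 * suc n + 2 + q          ≤⟨ +-monoˡ-≤ q (+-mono-≤ 2m≤p 2≤r) ⟩
      p + r + q                  ≤⟨ total′ ⟩
      4 * suc n                  ∎)))
      where
      open ≤-Reasoning
      e : ∀ t q → t + (q + 2) ≡ t + 2 + q
      e = solve-∀

    room-b-c : 2 * suc n ≤ p → q + r + 2 ≤ 4 * suc n
    room-b-c 2m≤p = begin
      q + r + 2                  ≤⟨ +-monoˡ-≤ 2 (cancel-2m (begin
                                      2 * suc n + (q + r)  ≡⟨ e (2 * suc n) q r ⟩
                                      2 * suc n + r + q    ≤⟨ +-monoˡ-≤ q (+-monoˡ-≤ r 2m≤p) ⟩
                                      p + r + q            ≤⟨ total′ ⟩
                                      4 * suc n            ∎)) ⟩
      2 * suc n + 2              ≤⟨ +-monoʳ-≤ (2 * suc n) (*-monoʳ-≤ 2 (s≤s z≤n)) ⟩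
      2 * suc n + 2 * suc n      ≡⟨ e′ n ⟩
      4 * suc n                  ∎
      where
      open ≤-Reasoning
      e : ∀ t q r → t + (q + r) ≡ t + r + q
      e = solve-∀
      e′ : ∀ n → 2 * suc n + 2 * suc n ≡ 4 * suc n
      e′ = solve-∀

    module NeighbourBlocked {y} (x∼y : x ∼ y) (y∉a : y ∉ layer a L) (y∈c : y ∈ layer c L) where

      2≤r : 2 ≤ r
      2≤r = ∈⇒2≤length (∼⇒≢ x∼y) x∈c y∈c

      2≤q : 2 ≤ q
      2≤q = ≤-trans 2≤r (c-lightest b)

      -- abstract: unfolding the witness search makes type checking blow up.
      abstract
        free : ∃ λ z → z ∉ layer a L × z ∉ layer c L
        free = common-∉-witness (layer a L) (layer c L) (room-a-c 2≤q)

      z : Vertex (suc n)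
      z = proj₁ free

      z∉a : z ∉ layer a L
      z∉a = proj₁ (proj₂ free)

      z∉c : z ∉ layer c L
      z∉c = proj₂ (proj₂ free)

      -- In the last case x and z are both isolated among the faults of the copies a and c,
      -- which are too few for two isolated vertices.
      reach : ReachesLayer L c (a ∷ x)
      reach with isolated-or-live (layer a L) z | isolated-or-live (layer a L ++ layer c L) x
      ... | inj₂ z-live | _ = z , z∉c ,
        lift-layer a (super-layers _ (a-few 2≤r 2≤q) x z x∉a z∉a (y , x∼y , y∉a) z-live) ◅◅ edge-across a≢c z∉a z∉c
      ... | inj₁ _ | inj₂ (w , x∼w , w∉a++c) = w , w∉c , lift-layer a (edge x∼w x∉a w∉a) ◅◅ edge-across a≢c w∉a w∉c
        where
        w∉a = w∉a++c ∘ ∈-++⁺ˡ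
        w∉c = w∉a++c ∘ ∈-++⁺ʳ (layer a L)
      ... | inj₁ z-isolated | inj₁ x-isolated = ⊥-elim (<-irrefl refl (begin
        suc (4 * suc n)                        ≤⟨ isolated-pair-size (suc n) x-isolated (∈-++⁺ˡ ∘ z-isolated)
                                                    (λ x≡z → z∉c (subst (_∈ layer c L) x≡z x∈c)) ([ z∉a , z∉c ]′ ∘ ∈-++⁻ (layer a L))
                                                    (counted (∈-++⁺ʳ (layer a L) x∈c)) ⟩
        length (layer a L ++ layer c L) + 2    ≡⟨ cong (_+ 2) (length-++ (layer a L)) ⟩
        p + r + 2                              ≤⟨ room-a-c 2≤q ⟩
        4 * suc n                              ∎))
        where open ≤-Reasoning

    via-a : HasLiveNeighbour (layer a L) x → ReachesLayer L c (a ∷ x)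
    via-a (y , x∼y , y∉a) with (c ∷ y) ∈? L
    ... | yes c∷y∈ = NeighbourBlocked.reach x∼y y∉a (∈-layer⁺ L c∷y∈)
    ... | no c∷y∉ = y , y∉c , lift-layer a (edge x∼y x∉a y∉a) ◅◅ edge-across a≢c y∉a y∉c
      where y∉c = c∷y∉ ∘ ∈-layer⁻ L

    -- All neighbours of u inside the copy a are faults, so leave through b ∷ x, which is
    -- not a fault since u is not isolated.
    module ThroughB (x-isolated-a : Isolated (layer a L) x) (x∉b : x ∉ layer b L) where

      2m≤p : 2 * suc n ≤ p
      2m≤p = isolated-size (suc n) x-isolated-a uncounted

      via-b-connected : 2 ≤ r → ReachesLayer L c (a ∷ x)
      via-b-connected 2≤r =
        let z , z∉b , z∉c = common-∉-witness (layer b L) (layer c L) (room-b-c 2m≤p)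
        in z , z∉c , edge-across a≢b x∉a x∉b
             ◅◅ lift-layer b (connectivity (suc n) (layer b L) (b-few 2m≤p 2≤r) x z x∉b z∉b)
             ◅◅ edge-across b≢c z∉b z∉c

      reach : ReachesLayer L c (a ∷ x)
      reach with isolated-or-live (layer b L) x
      ... | inj₁ x-isolated-b = ⊥-elim (too-many 2m≤p (isolated-size (suc n) x-isolated-b uncounted) (∈⇒1≤length x∈c))
      ... | inj₂ (y , x∼y , y∉b) with (c ∷ y) ∈? L
      ...   | yes c∷y∈ = via-b-connected (∈⇒2≤length (∼⇒≢ x∼y) x∈c (∈-layer⁺ L c∷y∈))
      ...   | no c∷y∉ = y , y∉c , edge-across a≢b x∉a x∉b ◅◅ lift-layer b (edge x∼y x∉b y∉b) ◅◅ edge-across b≢c y∉b y∉c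
        where y∉c = c∷y∉ ∘ ∈-layer⁻ L

    via-b : Isolated (layer a L) x → HasLiveNeighbour L (a ∷ x) → ReachesLayer L c (a ∷ x)
    via-b x-isolated-a (w , u∼w , w∉) with (b ∷ x) ∈? L
    ... | no b∷x∉ = ThroughB.reach x-isolated-a (b∷x∉ ∘ ∈-layer⁻ L)
    ... | yes b∷x∈ = ⊥-elim (w∉ (isolated-from-layer x-isolated-a other-copies u∼w))
      where
      other-copies : ∀ {d} → a ≢ d → (d ∷ x) ∈ L
      other-copies {d} a≢d with distinct₃-cover a c b acb d
      ... | inj₁ refl = ⊥-elim (a≢d refl)
      ... | inj₂ (inj₁ refl) = ∈-layer⁻ L x∈c
      ... | inj₂ (inj₂ refl) = b∷x∈

    reach : HasLiveNeighbour L (a ∷ x) → ReachesLayer L c (a ∷ x)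
    reach u-live with isolated-or-live (layer a L) x
    ... | inj₁ x-isolated-a = via-b x-isolated-a u-live
    ... | inj₂ x-live-a = via-a x-live-a

  reach : ∀ {u} → u ∉ L → HasLiveNeighbour L u → ReachesLayer L c u
  reach {a ∷ x} u∉ u-live =
    [ id , (λ (a≢c , x∈c) → Blocked.reach (proj₂ (third a c a≢c)) u∉ x∈c u-live) ]′ (reaches-or-blocked c L u∉)

  connected : NonIsolatedConnected L
  connected u v u∉ v∉ u-live v-live = connected-via-layer L layer-c-connected (reach u∉ u-live) (reach v∉ v-live)

superconnectivity : ∀ n (L : List (Vertex n)) → length L + 4 ≤ 4 * n → NonIsolatedConnected L
superconnectivity 0 L few with ≤-trans (m≤n+m 4 (length L)) few
... | ()
superconnectivity 1 L few u v u∉ v∉ _ _ = connectivity 1 L (s≤s (≤-trans (+-cancelʳ-≤ 4 (length L) 0 few) z≤n)) u v u∉ v∉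
superconnectivity (suc (suc n)) L few =
  let c , c-lightest = lightest-layer L in SuperStep.connected (superconnectivity (suc n)) L few c c-lightest

isolated-stays : ∀ {F} {x y : Vertex n} → Isolated F x → Connected F x y → y ≡ x
isolated-stays I ε = refl
isolated-stays I (_◅_ {j = z} (xz , _ , z∉) _) = ⊥-elim (z∉ (I (Adj⇒∼ {v = z} xz)))

no-second-isolated : ∀ n {F} {x y : Vertex n} → length F + 4 ≤ 4 * n →
  Isolated F x → Isolated F y → x ≢ y → y ∉ F → ⊥
no-second-isolated n {F} few x-isolated y-isolated x≢y y∉ with
  +-cancelˡ-≤ (length F) 4 2 (≤-trans few (isolated-pair-size n x-isolated y-isolated x≢y y∉ uncounted))
... | s≤s (s≤s ())

isolated-component : ∀ n {F} {x w : Vertex n} → length F + 4 ≤ 4 * n →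
  Isolated F x → x ∉ F → w ∉ F → w ≢ x → TwoComponentsOneTrivial F
isolated-component n {F} {x} {w} few x-isolated x∉ w∉ w≢x =
  x , x∉ , (λ _ _ → isolated-stays x-isolated) , others-connected , (w , w∉ , w≢x)
  where
  live : ∀ {y} → y ∉ F → y ≢ x → HasLiveNeighbour F y
  live {y} y∉ y≢x with isolated-or-live F y
  ... | inj₁ y-isolated = ⊥-elim (no-second-isolated n few x-isolated y-isolated (y≢x ∘ sym) y∉)
  ... | inj₂ y-live = y-live
  others-connected : ∀ y z → y ∉ F → z ∉ F → y ≢ x → z ≢ x → Connected F y z
  others-connected y z y∉ z∉ y≢x z≢x = superconnectivity n F few y z y∉ z∉ (live y∉ y≢x) (live z∉ z≢x)

lemma3p3 : (n : ℕ) → 2 ≤ n → (F : List (Vertex n)) →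
    Disconnected F → length F ≤ 4 * n ∸ 4 → TwoComponentsOneTrivial F
lemma3p3 n 2≤n F (u , v , u∉ , v∉ , u≁v) |F|≤4n-4 = cases (isolated-or-live F u) (isolated-or-live F v)
  where
  few : length F + 4 ≤ 4 * n
  few = ≤-trans (+-monoˡ-≤ 4 |F|≤4n-4) (≤-reflexive (m∸n+n≡m (*-monoʳ-≤ 4 (≤-trans (s≤s z≤n) 2≤n))))
  u≢v : u ≢ v
  u≢v refl = u≁v ε
  cases : Isolated F u ⊎ HasLiveNeighbour F u → Isolated F v ⊎ HasLiveNeighbour F v → TwoComponentsOneTrivial F
  cases (inj₁ u-isolated) _ = isolated-component n few u-isolated u∉ v∉ (u≢v ∘ sym)
  cases (inj₂ _) (inj₁ v-isolated) = isolated-component n few v-isolated v∉ u∉ u≢v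
  cases (inj₂ u-live) (inj₂ v-live) = ⊥-elim (u≁v (superconnectivity n F few u v u∉ v∉ u-live v-live))
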